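{- Let $G$ be a finite simple graph with no ds-completable vertex. Let $i \subseteq V$ be a vertex set such that $\bar{i} = V \setminus i$ is neighbourly, and let $p = \bar{i} \cap D$, $n_p = |p|$. Then for every number $\tau$ with $\tau \ge \epsilon(i,p)$ one has $\epsilon(p,p) \le n_p(n_p-2) + \tau$; in particular $\epsilon(p,p) \le n_p(n_p-2) + \epsilon(i,p)$.
   Context: $V$ is the vertex set, $d_x$ the degree of $x$. A vertex is ds-completable if, for each integer $d$, the vertices having degree $d$ in $G-v$ are either all neighbours of $v$ in $G$ or all non-neighbours. A vertex is dull if $G$ contains a vertex of degree one more than its degree; $D$ is the set of dull vertices. A vertex set $K$ is neighbourly if no vertex outside $K$ has degree one less than the degree of some vertex of $K$, i.e. $\{d_u : u \notin K\} \cap \{d_u - 1 : u \in K\} = \emptyset$. For vertex sets $j,k$, $\epsilon(j,k) = \sum_{x \in j} |N(x) \cap k|$ (the number of stubs in $j$ on edges between $j$ and $k$; when $j=k$ it is twice the number of edges within $j$). In the paper this is stated as $\tau(p,p) \le n_p(n_p-2)+\tau(i,p)$ with $\tau$ denoting upper bounds on $\epsilon$. -}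

module Defs where

open import Data.Nat using (ℕ; suc)
open import Data.Bool using (Bool; true; false; if_then_else_; _∧_; not)
open import Data.Fin using (Fin)
open import Data.List using (List; filter; length; map; allFin)
open import Data.Nat.ListAction using (sum)
open import Data.Bool.ListAction using (any)
open import Data.Product using (_×_; Σ; ∃; _,_)
open import Relation.Binary.PropositionalEquality using (_≡_; _≢_)
open import Relation.Nullary using (¬_)

record Graph (n : ℕ) : Set where
  field
    adj   : Fin n → Fin n → Bool
    sym   : ∀ x y → adj x y ≡ adj y x
    irrefl : ∀ x → adj x x ≡ false
open Graph public

VSet : ℕ → Set
VSet n = Fin n → Bool

countB : ∀ {n} → (Fin n → Bool) → ℕ
countB {n} P = length (filter (λ x → Data.Bool._≟_ (P x) true) (allFin n))
  where import Data.Bool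

card : ∀ {n} → VSet n → ℕ
card S = countB S

complement : ∀ {n} → VSet n → VSet n
complement S x = not (S x)

_∩_ : ∀ {n} → VSet n → VSet n → VSet n
(S ∩ T) x = S x ∧ T x

deg : ∀ {n} → Graph n → Fin n → ℕ
deg G x = countB (adj G x)

-- degree of x in G - v (for x ≠ v): neighbours of x other than v
degMinus : ∀ {n} → Graph n → Fin n → Fin n → ℕ
degMinus G v x = countB (λ y → adj G x y ∧ not (isEq y v))
  where
    import Data.Fin as F
    open import Relation.Nullary.Decidable using (⌊_⌋)
    isEq : _ → _ → Bool
    isEq a b = ⌊ a F.≟ b ⌋

DsCompletable : ∀ {n} → Graph n → Fin n → Set
DsCompletable G v =
  ∀ (d : ℕ) →
    (∀ w → w ≢ v → degMinus G v w ≡ d → adj G v w ≡ true)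
    Data.Sum.⊎
    (∀ w → w ≢ v → degMinus G v w ≡ d → adj G v w ≡ false)
  where import Data.Sum

Dull : ∀ {n} → Graph n → Fin n → Set
Dull G x = ∃ λ y → deg G y ≡ suc (deg G x)

dullB : ∀ {n} → Graph n → VSet n
dullB {n} G x = any (λ y → ⌊ deg G y Data.Nat.≟ suc (deg G x) ⌋) (allFin n)
  where
    import Data.Nat
    open import Relation.Nullary.Decidable using (⌊_⌋)

-- K is neighbourly: no u ∉ K, w ∈ K with d_u = d_w - 1 (i.e. d_u + 1 = d_w)
Neighbourly : ∀ {n} → Graph n → VSet n → Set
Neighbourly G K =
  ∀ u w → K u ≡ false → K w ≡ true → ¬ (suc (deg G u) ≡ deg G w)

eps : ∀ {n} → Graph n → VSet n → VSet n → ℕ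
eps G j k = sum (map (λ x → if j x then countB (λ y → adj G x y ∧ k y) else 0) (allFin _))

module Submission where

-- Every x ∈ p satisfies the
-- vertex bound
--        2 + |N(x) ∩ p|  ≤  n_p + |N(x) ∩ i| .
-- Indeed x ∉ N(x), so if x has a non-neighbour y ≠ x in p, already
-- |N(x) ∩ p| ≤ n_p - 2.  Otherwise |N(x) ∩ p| ≤ n_p - 1 and x must have a
-- neighbour in i: if it had none, a neighbour w and a non-neighbour u of x
-- with equal degree in G - x would satisfy d_w = d_u + 1, so u is dull; w ∈ ī
-- since it is a neighbour of x, so neighbourliness of ī forces u ∈ ī, hence
-- u ∈ p is a non-neighbour of x — impossible.  Thus no such pair w, u
-- exists and x would be ds-completable.  Summing the vertex bound over p gives
-- 2 n_p + ε(p,p) ≤ n_p² + ε(p,i), and ε(p,i) = ε(i,p) ≤ τ finishes over ℤ.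

open import Defs hiding (sym)
open import Defs using () renaming (sym to adj-sym)
open import Data.Nat using (ℕ; zero; suc; _+_; _*_; _≤_; z≤n; s≤s)
open import Data.Nat.Properties
import Data.Nat as ℕ
import Data.Nat.ListAction as List
open import Data.Bool using (Bool; true; false; _∧_; not; if_then_else_)
import Data.Bool as Bool
open import Data.Bool.Properties using (∧-comm; ∧-assoc; ¬-not; T-≡)
open import Data.Fin using (Fin; zero; suc)
import Data.Fin as Fin
import Data.Fin.Properties as Finₚ
open import Data.List using (List; []; _∷_; filter; length; map; allFin; tabulate)
open import Data.List.Properties using (map-tabulate)
open import Data.List.Membership.Propositional using (lose)
open import Data.List.Membership.Propositional.Properties using (∈-allFin)
open import Data.List.Relation.Unary.Any.Properties using (any⁺)
open import Data.Product using (∃; _×_; _,_)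
open import Data.Sum using (_⊎_; inj₁; inj₂)
open import Data.Empty using (⊥; ⊥-elim)
open import Function using (_∘_; id; case_of_; Equivalence)
open import Relation.Nullary using (¬_; yes; no)
open import Relation.Nullary.Decidable using (⌊_⌋; _×-dec_; ¬?; fromWitness)
open import Relation.Binary.PropositionalEquality
open import Algebra.Properties.Semiring.Sum +-*-semiring
  using (sum; sum-cong-≗; ∑-distrib-+; ∑-comm; sum-replicate-zero; *-distribʳ-sum)
open import Data.Integer as ℤ using (ℤ; +_; -_; _-_) renaming (_+_ to _+ℤ_; _*_ to _*ℤ_; _≤_ to _≤ℤ_)
import Data.Integer.Properties as ℤₚ
open import Data.Integer.Tactic.RingSolver using (solve-∀)

𝟙 : Bool → ℕ
𝟙 true = 1
𝟙 false = 0

count : ∀ {n} → (Fin n → Bool) → ℕ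
count P = sum (𝟙 ∘ P)

-- Boolean equality test on Fin n (the one used by degMinus in Defs).
_≡ᵇ_ : ∀ {n} → Fin n → Fin n → Bool
a ≡ᵇ b = ⌊ a Fin.≟ b ⌋

_─_ : ∀ {n} → (Fin n → Bool) → Fin n → (Fin n → Bool)
(P ─ x) z = P z ∧ not (z ≡ᵇ x)

∧-true : ∀ {a b} → a ∧ b ≡ true → a ≡ true × b ≡ true
∧-true {true} {true} _ = refl , refl

-- Specification of _≡ᵇ_ (⌊_⌋ does not compute on open terms).
≡ᵇ-refl : ∀ {n} (x : Fin n) → x ≡ᵇ x ≡ true
≡ᵇ-refl x with x Fin.≟ x
... | yes _ = refl
... | no x≢x = ⊥-elim (x≢x refl)

≡ᵇ-false : ∀ {n} {z x : Fin n} → z ≢ x → z ≡ᵇ x ≡ false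
≡ᵇ-false {z = z} {x} z≢x with z Fin.≟ x
... | yes z≡x = ⊥-elim (z≢x z≡x)
... | no _ = refl

≡ᵇ-suc : ∀ {n} (z x : Fin n) → suc z ≡ᵇ suc x ≡ z ≡ᵇ x
≡ᵇ-suc z x with z Fin.≟ x
... | yes _ = refl
... | no _ = refl

∈-─ : ∀ {n} {P : Fin n → Bool} {x z} → (P ─ x) z ≡ true → P z ≡ true × z ≢ x
∈-─ {P = P} {x} {z} Pz─x with ∧-true {P z} Pz─x
... | Pz , z≢ᵇx = Pz , λ { refl → case trans (sym z≢ᵇx) (cong not (≡ᵇ-refl x)) of λ () }

─-∈ : ∀ {n} {P : Fin n → Bool} {x z} → P z ≡ true → z ≢ x → (P ─ x) z ≡ true
─-∈ Pz z≢x = cong₂ _∧_ Pz (cong not (≡ᵇ-false z≢x))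

sum-mono : ∀ {n} {f g : Fin n → ℕ} → (∀ x → f x ≤ g x) → sum f ≤ sum g
sum-mono {zero} _ = z≤n
sum-mono {suc n} f≤g = +-mono-≤ (f≤g zero) (sum-mono (f≤g ∘ suc))

count-⊆ : ∀ {n} {P Q : Fin n → Bool} → (∀ z → Q z ≡ true → P z ≡ true) → count Q ≤ count P
count-⊆ {P = P} {Q} Q⊆P = sum-mono pointwise
  where
  pointwise : ∀ z → 𝟙 (Q z) ≤ 𝟙 (P z)
  pointwise z with Q z in Qz
  ... | false = z≤n
  ... | true rewrite Q⊆P z Qz = ≤-refl

count-at : ∀ {n} (x : Fin n) (P : Fin n → Bool) → count (λ z → z ≡ᵇ x ∧ P z) ≡ 𝟙 (P x)
count-at {suc n} zero P = trans (cong₂ _+_ refl (sum-replicate-zero n)) (+-identityʳ _)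
count-at (suc x) P =
  trans (sum-cong-≗ λ z → cong (λ b → 𝟙 (b ∧ P (suc z))) (≡ᵇ-suc z x)) (count-at x (P ∘ suc))

count-split : ∀ {n} (P : Fin n → Bool) (x : Fin n) → count P ≡ count (P ─ x) + 𝟙 (P x)
count-split P x = begin
  count P
    ≡⟨ sum-cong-≗ (λ z → sym (𝟙-split (P z) (z ≡ᵇ x))) ⟩
  sum (λ z → 𝟙 ((P ─ x) z) + 𝟙 (z ≡ᵇ x ∧ P z))
    ≡⟨ ∑-distrib-+ (𝟙 ∘ (P ─ x)) (λ z → 𝟙 (z ≡ᵇ x ∧ P z)) ⟩
  count (P ─ x) + count (λ z → z ≡ᵇ x ∧ P z)
    ≡⟨ cong₂ _+_ refl (count-at x P) ⟩
  count (P ─ x) + 𝟙 (P x) ∎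
  where
  open ≡-Reasoning
  𝟙-split : ∀ a e → 𝟙 (a ∧ not e) + 𝟙 (e ∧ a) ≡ 𝟙 a
  𝟙-split true true = refl
  𝟙-split true false = refl
  𝟙-split false true = refl
  𝟙-split false false = refl

count-avoid : ∀ {n} {P Q : Fin n → Bool} {x} → P x ≡ true →
  (∀ z → Q z ≡ true → P z ≡ true × z ≢ x) → suc (count Q) ≤ count P
count-avoid {P = P} {Q} {x} Px Q-avoids-x = begin
  suc (count Q)           ≤⟨ s≤s (count-⊆ {P = P ─ x} {Q} Q⊆P─x) ⟩
  suc (count (P ─ x))     ≡⟨ +-comm 1 _ ⟩
  count (P ─ x) + 1       ≡⟨ cong (λ b → count (P ─ x) + 𝟙 b) (sym Px) ⟩
  count (P ─ x) + 𝟙 (P x) ≡⟨ sym (count-split P x) ⟩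
  count P                 ∎
  where
  open ≤-Reasoning
  Q⊆P─x : ∀ z → Q z ≡ true → (P ─ x) z ≡ true
  Q⊆P─x z Qz = let (Pz , z≢x) = Q-avoids-x z Qz in ─-∈ {P = P} Pz z≢x

count-pos : ∀ {n} {P : Fin n → Bool} {x} → P x ≡ true → 1 ≤ count P
count-pos {P = P} Px = ≤-trans (s≤s z≤n) (count-avoid {P = P} {Q = λ _ → false} Px (λ _ ()))

-- The list-based counts and sums of Defs agree with those above: filtering
-- by a Boolean predicate keeps one element per indicator.
length-filter : ∀ {A : Set} (P : A → Bool) (xs : List A) →
  length (filter (λ x → P x Bool.≟ true) xs) ≡ List.sum (map (𝟙 ∘ P) xs)
length-filter P [] = refl
length-filter P (x ∷ xs) with P x
... | true = cong suc (length-filter P xs)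
... | false = length-filter P xs

listSum-allFin : ∀ {n} (f : Fin n → ℕ) → List.sum (map f (allFin n)) ≡ sum f
listSum-allFin f = trans (cong List.sum (map-tabulate id f)) (listSum-tabulate f)
  where
  listSum-tabulate : ∀ {n} (f : Fin n → ℕ) → List.sum (tabulate f) ≡ sum f
  listSum-tabulate {zero} f = refl
  listSum-tabulate {suc n} f = cong₂ _+_ refl (listSum-tabulate (f ∘ suc))

countB≡count : ∀ {n} (P : Fin n → Bool) → countB P ≡ count P
countB≡count P = trans (length-filter P (allFin _)) (listSum-allFin (𝟙 ∘ P))

eps-weighted : ∀ {n} (G : Graph n) (j k : VSet n) →
  eps G j k ≡ sum (λ x → 𝟙 (j x) * count (λ y → adj G x y ∧ k y))
eps-weighted G j k =
  trans (listSum-allFin (λ x → if j x then countB (λ y → adj G x y ∧ k y) else 0))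
    (sum-cong-≗ λ x → if-count (j x) (λ y → adj G x y ∧ k y))
  where
  if-count : ∀ {n} b (Q : Fin n → Bool) → (if b then countB Q else 0) ≡ 𝟙 b * count Q
  if-count true Q = trans (countB≡count Q) (sym (*-identityˡ _))
  if-count false Q = refl

-- ε is symmetric: each edge between j and k is counted once from either side.
eps-sym : ∀ {n} (G : Graph n) (j k : VSet n) → eps G j k ≡ eps G k j
eps-sym G j k = begin
  eps G j k
    ≡⟨ eps-double j k ⟩
  sum (λ x → sum (λ y → 𝟙 (j x ∧ (adj G x y ∧ k y))))
    ≡⟨ sum-cong-≗ (λ x → sum-cong-≗ λ y → cong 𝟙 (flip x y)) ⟩
  sum (λ x → sum (λ y → 𝟙 (k y ∧ (adj G y x ∧ j x))))
    ≡⟨ ∑-comm (λ x y → 𝟙 (k y ∧ (adj G y x ∧ j x))) ⟩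
  sum (λ y → sum (λ x → 𝟙 (k y ∧ (adj G y x ∧ j x))))
    ≡⟨ sym (eps-double k j) ⟩
  eps G k j ∎
  where
  open ≡-Reasoning
  guard-count : ∀ {n} b (Q : Fin n → Bool) → 𝟙 b * count Q ≡ count (λ y → b ∧ Q y)
  guard-count true Q = *-identityˡ _
  guard-count {n} false Q = sym (sum-replicate-zero n)
  eps-double : ∀ (j k : VSet _) → eps G j k ≡ sum (λ x → sum (λ y → 𝟙 (j x ∧ (adj G x y ∧ k y))))
  eps-double j k = trans (eps-weighted G j k) (sum-cong-≗ λ x → guard-count (j x) (λ y → adj G x y ∧ k y))
  flip : ∀ x y → j x ∧ (adj G x y ∧ k y) ≡ k y ∧ (adj G y x ∧ j x)
  flip x y = begin
    j x ∧ (adj G x y ∧ k y) ≡⟨ ∧-comm (j x) _ ⟩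
    (adj G x y ∧ k y) ∧ j x ≡⟨ cong (_∧ j x) (∧-comm (adj G x y) (k y)) ⟩
    (k y ∧ adj G x y) ∧ j x ≡⟨ ∧-assoc (k y) _ _ ⟩
    k y ∧ (adj G x y ∧ j x) ≡⟨ cong (λ b → k y ∧ (b ∧ j x)) (adj-sym G x y) ⟩
    k y ∧ (adj G y x ∧ j x) ∎

module Degrees {n} (G : Graph n) where

  degree-split : ∀ v w → deg G w ≡ degMinus G v w + 𝟙 (adj G v w)
  degree-split v w = begin
    deg G w
      ≡⟨ countB≡count (adj G w) ⟩
    count (adj G w)
      ≡⟨ count-split (adj G w) v ⟩
    count (adj G w ─ v) + 𝟙 (adj G w v)
      ≡⟨ cong₂ (λ d b → d + 𝟙 b) (sym (countB≡count (adj G w ─ v))) (adj-sym G w v) ⟩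
    degMinus G v w + 𝟙 (adj G v w) ∎
    where open ≡-Reasoning

  degree-step : ∀ {v w u} → adj G v w ≡ true → adj G v u ≡ false →
    degMinus G v w ≡ degMinus G v u → deg G w ≡ suc (deg G u)
  degree-step {v} {w} {u} vw vu same = begin
    deg G w                                  ≡⟨ degree-split v w ⟩
    degMinus G v w + 𝟙 (adj G v w)           ≡⟨ cong₂ (λ d b → d + 𝟙 b) same vw ⟩
    degMinus G v u + 1                       ≡⟨ +-suc _ 0 ⟩
    suc (degMinus G v u + 0)                 ≡⟨ cong (λ b → suc (degMinus G v u + 𝟙 b)) (sym vu) ⟩
    suc (degMinus G v u + 𝟙 (adj G v u))     ≡⟨ cong suc (sym (degree-split v u)) ⟩
    suc (deg G u)                            ∎
    where open ≡-Reasoning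

  dull-by-witness : ∀ {w u} → deg G w ≡ suc (deg G u) → dullB G u ≡ true
  dull-by-witness {w} dw≡du+1 =
    Equivalence.to T-≡ (any⁺ _ (lose (∈-allFin w) (fromWitness dw≡du+1)))

  ds-completable-if-separated : ∀ v →
    (∀ w u → w ≢ v → u ≢ v → adj G v w ≡ true → adj G v u ≡ false →
       degMinus G v w ≢ degMinus G v u) →
    DsCompletable G v
  ds-completable-if-separated v separated d
    with Finₚ.any? (λ w → ¬? (w Finₚ.≟ v) ×-dec (degMinus G v w ℕ.≟ d ×-dec (adj G v w Bool.≟ true)))
  ... | yes (w , w≢v , dw , vw) =
        inj₁ λ u u≢v du → ¬-not λ vu → separated w u w≢v u≢v vw vu (trans dw (sym du))
  ... | no no-neighbour =
        inj₂ λ u u≢v du → ¬-not λ vu → no-neighbour (u , u≢v , du , vu)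

module Bound {n} (G : Graph n) (no-ds : ∀ v → ¬ DsCompletable G v)
             (i : VSet n) (neighbourly : Neighbourly G (complement i)) where
  open Degrees G

  p : VSet n
  p = complement i ∩ dullB G

  non-neighbour-or-i-neighbour : ∀ {x} → p x ≡ true →
    (∃ λ y → y ≢ x × p y ≡ true × adj G x y ≡ false) ⊎ (∃ λ y → adj G x y ∧ i y ≡ true)
  non-neighbour-or-i-neighbour {x} px
    with Finₚ.any? (λ y → ¬? (y Finₚ.≟ x) ×-dec (p y Bool.≟ true ×-dec adj G x y Bool.≟ false))
  ... | yes non-neighbour = inj₁ non-neighbour
  ... | no no-non-neighbour with Finₚ.any? (λ y → adj G x y ∧ i y Bool.≟ true)
  ...   | yes i-neighbour = inj₂ i-neighbour
  ...   | no no-i-neighbour = ⊥-elim (no-ds x (ds-completable-if-separated x separated))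
    where
    -- a neighbour w and a non-neighbour u of x with equal degree in G - x
    -- would give u ∈ p, contradicting the absence of non-neighbours in p
    separated : ∀ w u → w ≢ x → u ≢ x → adj G x w ≡ true → adj G x u ≡ false →
      degMinus G x w ≢ degMinus G x u
    separated w u w≢x u≢x xw xu same = u-placement (i u) refl
      where
      w-step : deg G w ≡ suc (deg G u)
      w-step = degree-step xw xu same
      w∉i : i w ≡ false
      w∉i = ¬-not λ iw → no-i-neighbour (w , cong₂ _∧_ xw iw)
      -- u ∈ i violates neighbourliness of ī; u ∉ i puts u into p
      u-placement : ∀ b → i u ≡ b → ⊥
      u-placement true iu = neighbourly u w (cong not iu) (cong not w∉i) (sym w-step)
      u-placement false iu =
        no-non-neighbour (u , u≢x , cong₂ _∧_ (cong not iu) (dull-by-witness w-step) , xu)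

  Nₚ Nᵢ : Fin n → VSet n
  Nₚ x y = adj G x y ∧ p y
  Nᵢ x y = adj G x y ∧ i y

  Nₚ-avoids : ∀ {x y z} → adj G x y ≡ false → Nₚ x z ≡ true → p z ≡ true × z ≢ y
  Nₚ-avoids {x} {z = z} xy xz∧pz with ∧-true {adj G x z} xz∧pz
  ... | xz , pz = pz , λ { refl → case trans (sym xz) xy of λ () }

  vertex-bound : ∀ {x} → p x ≡ true → 2 + count (Nₚ x) ≤ count p + count (Nᵢ x)
  vertex-bound {x} px with non-neighbour-or-i-neighbour px
  ... | inj₁ (y , y≢x , py , xy) = ≤-trans (s≤s Nₚ-below-p─x) (≤-trans p─x-below-p (m≤m+n _ _))
    where
    -- N(x) ∩ p misses both x and y
    Nₚ-below-p─x : suc (count (Nₚ x)) ≤ count (p ─ x)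
    Nₚ-below-p─x = count-avoid {P = p ─ x} (─-∈ {P = p} py y≢x) λ z xz →
      let (pz , z≢y) = Nₚ-avoids xy xz
          (_  , z≢x) = Nₚ-avoids (irrefl G x) xz
      in ─-∈ {P = p} pz z≢x , z≢y
    p─x-below-p : suc (count (p ─ x)) ≤ count p
    p─x-below-p = count-avoid {P = p} px λ z → ∈-─ {P = p}
  ... | inj₂ (y , xy∧iy) = subst (_≤ count p + count (Nᵢ x)) (+-comm (suc (count (Nₚ x))) 1)
      (+-mono-≤ (count-avoid {P = p} px λ z → Nₚ-avoids (irrefl G x)) (count-pos {P = Nᵢ x} xy∧iy))

  summed-bound : count p * 2 + eps G p p ≤ count p * count p + eps G p i
  summed-bound = begin
    count p * 2 + eps G p p
      ≡⟨ cong₂ _+_ (*-distribʳ-sum 2 (𝟙 ∘ p)) (eps-weighted G p p) ⟩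
    sum (λ x → 𝟙 (p x) * 2) + sum (λ x → 𝟙 (p x) * count (Nₚ x))
      ≡⟨ sym (weighted-+ (𝟙 ∘ p) (λ _ → 2) (count ∘ Nₚ)) ⟩
    sum (λ x → 𝟙 (p x) * (2 + count (Nₚ x)))
      ≤⟨ sum-mono weighted-vertex-bound ⟩
    sum (λ x → 𝟙 (p x) * (count p + count (Nᵢ x)))
      ≡⟨ weighted-+ (𝟙 ∘ p) (λ _ → count p) (count ∘ Nᵢ) ⟩
    sum (λ x → 𝟙 (p x) * count p) + sum (λ x → 𝟙 (p x) * count (Nᵢ x))
      ≡⟨ cong₂ _+_ (sym (*-distribʳ-sum (count p) (𝟙 ∘ p))) (sym (eps-weighted G p i)) ⟩
    count p * count p + eps G p i ∎
    where
    open ≤-Reasoning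
    weighted-+ : (w f g : Fin n → ℕ) →
      sum (λ x → w x * (f x + g x)) ≡ sum (λ x → w x * f x) + sum (λ x → w x * g x)
    weighted-+ w f g = trans (sum-cong-≗ λ x → *-distribˡ-+ (w x) (f x) (g x))
                             (∑-distrib-+ (λ x → w x * f x) (λ x → w x * g x))
    weighted-vertex-bound : ∀ x → 𝟙 (p x) * (2 + count (Nₚ x)) ≤ 𝟙 (p x) * (count p + count (Nᵢ x))
    weighted-vertex-bound x with p x in px
    ... | true = *-monoʳ-≤ 1 (vertex-bound px)
    ... | false = z≤n

-- The final rearrangement over ℤ, where n_p - 2 may be negative:
-- from 2m + e ≤ m² + a and a ≤ τ follows e ≤ m(m - 2) + τ.
rearrange : ∀ (e m a τ : ℤ) → m *ℤ + 2 +ℤ e ≤ℤ m *ℤ m +ℤ a → a ≤ℤ τ → e ≤ℤ m *ℤ (m - + 2) +ℤ τ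
rearrange e m a τ h a≤τ = begin
  e                            ≡⟨ shift-out e m ⟩
  (m *ℤ + 2 +ℤ e) - m *ℤ + 2   ≤⟨ ℤₚ.+-monoˡ-≤ (- (m *ℤ + 2)) h ⟩
  (m *ℤ m +ℤ a) - m *ℤ + 2     ≡⟨ shift-in m a ⟩
  m *ℤ (m - + 2) +ℤ a          ≤⟨ ℤₚ.+-monoʳ-≤ (m *ℤ (m - + 2)) a≤τ ⟩
  m *ℤ (m - + 2) +ℤ τ          ∎
  where
  open ℤₚ.≤-Reasoning
  shift-out : ∀ e m → e ≡ (m *ℤ + 2 +ℤ e) - m *ℤ + 2
  shift-out = solve-∀
  shift-in : ∀ m a → (m *ℤ m +ℤ a) - m *ℤ + 2 ≡ m *ℤ (m - + 2) +ℤ a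
  shift-in = solve-∀

cast-bound : ∀ {m e a} → m * 2 + e ≤ m * m + a → + m *ℤ + 2 +ℤ + e ≤ℤ + m *ℤ + m +ℤ + a
cast-bound {m} {e} {a} h = subst₂ _≤ℤ_ (cast m 2 e) (cast m m a) (ℤ.+≤+ h)
  where
  cast : ∀ x y z → + (x * y + z) ≡ + x *ℤ + y +ℤ + z
  cast x y z = trans (ℤₚ.pos-+ (x * y) z) (cong (_+ℤ + z) (ℤₚ.pos-* x y))

lemma6 : ∀ {n} (G : Graph n) →
    (∀ v → ¬ DsCompletable G v) →
    (i : VSet n) →
    Neighbourly G (complement i) →
    (τ : ℤ) →
    + eps G i (complement i ∩ dullB G) ≤ℤ τ →
    + eps G (complement i ∩ dullB G) (complement i ∩ dullB G)
    ≤ℤ (+ card (complement i ∩ dullB G)) *ℤ (+ card (complement i ∩ dullB G) - + 2) +ℤ τ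
lemma6 G no-ds i neighbourly τ εᵢₚ≤τ =
  subst (λ m → + eps G p p ≤ℤ + m *ℤ (+ m - + 2) +ℤ τ) (sym (countB≡count p))
    (rearrange (+ eps G p p) (+ count p) (+ eps G p i) τ
      (cast-bound {count p} summed-bound)
      (subst (λ e → + e ≤ℤ τ) (eps-sym G i p) εᵢₚ≤τ))
  where open Bound G no-ds i neighbourly
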